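{- Let $A$ be a finite alphabet and $f\colon A^*\to A^*$ a Parikh-collinear morphism prolongable on $a\in A$, such that every letter of $A$ occurs in $f^n(a)$ for some $n$, and such that $\mathbf{x}=f^{\omega}(a)$ is aperiodic (not ultimately periodic). Then the shift space $\mathsf{X}(f)$ is aperiodic.
   Context: A morphism is Parikh-collinear if the Parikh vectors (vectors of letter counts) of the images of letters are pairwise $\mathbb{Z}$-linearly dependent. $f$ is prolongable on $a$ if $f(a)=au$ and $|f^n(a)|\to\infty$; $f^{\omega}(a)=\lim_n f^n(a)$. The shift $S\colon A^{\mathbb{Z}}\to A^{\mathbb{Z}}$ is $(z_n)_{n\in\mathbb{Z}}\mapsto(z_{n+1})_{n\in\mathbb{Z}}$. Let $\mathcal{L}(f)=\bigcup_{n\ge0}\bigcup_{b\in A}\mathrm{Fac}(f^n(b))$ (set of factors) and $\mathsf{X}(f)=\{\mathbf{z}\in A^{\mathbb{Z}}\colon \text{every factor of } \mathbf{z} \text{ lies in } \mathcal{L}(f)\}$. A bi-infinite word $\mathbf{z}$ is periodic if $S^n(\mathbf{z})=\mathbf{z}$ for some $n\ge1$; a shift space is aperiodic if none of its elements is periodic. -}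

module Defs where

open import Data.Nat as ℕ using (ℕ; zero; suc; _≤_; _<_)
open import Data.Integer as ℤ using (ℤ; +_)
open import Data.Fin using (Fin)
open import Data.Fin.Properties using () renaming (_≟_ to _≟ᶠ_)
open import Data.List using (List; []; _∷_; _++_; length; map; upTo; concatMap; lookup)
open import Data.List.Membership.Propositional using (_∈_)
open import Data.Product using (Σ; ∃; ∃-syntax; _×_; _,_)
open import Relation.Binary.PropositionalEquality using (_≡_; _≢_)
open import Relation.Nullary using (¬_; yes; no)

Morphism : ℕ → Set
Morphism k = Fin k → List (Fin k)

apply : ∀ {k} → Morphism k → List (Fin k) → List (Fin k)
apply f w = concatMap f w

iter : ∀ {k} → Morphism k → ℕ → List (Fin k) → List (Fin k)
iter f zero    w = w
iter f (suc n) w = apply f (iter f n w)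

count : ∀ {k} → Fin k → List (Fin k) → ℕ
count b []      = 0
count b (c ∷ w) with b ≟ᶠ c
... | yes _ = suc (count b w)
... | no  _ = count b w

parikh : ∀ {k} → List (Fin k) → Fin k → ℕ
parikh w b = count b w

LinDep : ∀ {k} → (Fin k → ℕ) → (Fin k → ℕ) → Set
LinDep {k} v w = Σ ℤ λ p → Σ ℤ λ q →
  ¬ (p ≡ + 0 × q ≡ + 0) × (∀ (b : Fin k) → p ℤ.* + v b ℤ.+ q ℤ.* + w b ≡ + 0)

ParikhCollinear : ∀ {k} → Morphism k → Set
ParikhCollinear {k} f = ∀ (b c : Fin k) → LinDep (parikh (f b)) (parikh (f c))

Prolongable : ∀ {k} → Morphism k → Fin k → Set
Prolongable f a =
  (Σ (List _) λ u → f a ≡ a ∷ u) ×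
  (∀ (N : ℕ) → ∃[ n ] N ≤ length (iter f n (a ∷ [])))

IsFixedPointLimit : ∀ {k} → Morphism k → Fin k → (ℕ → Fin k) → Set
IsFixedPointLimit f a x =
  ∀ (n : ℕ) (i : Fin (length (iter f n (a ∷ [])))) →
    x (Data.Fin.toℕ i) ≡ lookup (iter f n (a ∷ [])) i

UltimatelyPeriodic : ∀ {k} → (ℕ → Fin k) → Set
UltimatelyPeriodic x = ∃[ p ] ∃[ N ] (0 < p × (∀ i → N ≤ i → x (i ℕ.+ p) ≡ x i))

IsFactor : ∀ {k} → List (Fin k) → List (Fin k) → Set
IsFactor w v = ∃[ u ] ∃[ t ] (v ≡ u ++ w ++ t)

InLanguage : ∀ {k} → Morphism k → List (Fin k) → Set
InLanguage {k} f w = ∃[ n ] Σ (Fin k) λ b → IsFactor w (iter f n (b ∷ []))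

window : ∀ {k} → (ℤ → Fin k) → ℤ → ℕ → List (Fin k)
window z i m = map (λ j → z (i ℤ.+ + j)) (upTo m)

InShift : ∀ {k} → Morphism k → (ℤ → Fin k) → Set
InShift f z = ∀ (i : ℤ) (m : ℕ) → InLanguage f (window z i m)

shift : ∀ {k} → (ℤ → Fin k) → (ℤ → Fin k)
shift z i = z (i ℤ.+ + 1)

shiftN : ∀ {k} → ℕ → (ℤ → Fin k) → (ℤ → Fin k)
shiftN zero    z = z
shiftN (suc n) z = shift (shiftN n z)

Periodic : ∀ {k} → (ℤ → Fin k) → Set
Periodic z = ∃[ n ] (1 ≤ n × (∀ i → shiftN n z i ≡ z i))

AperiodicShift : ∀ {k} → Morphism k → Set
AperiodicShift f = ∀ z → InShift f z → ¬ Periodic z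

{-# OPTIONS --safe #-}
-- Since f(a) = a u has a nonzero Parikh vector at a, collinearity puts a into every nonempty
-- image f(c); hence every nonempty block f^n(f c) of f^(n+1)(y) = f^n(f y₁) ⋯ f^n(f yₗ)
-- contains f^n(a).  Every word of L(f) is a factor of some f^m(a), hence of f^(n+1)(f^m(a)),
-- so once it is longer than twice the maximal block length it contains f^n(a).  Thus every
-- prefix f^n(a) of x occurs in each z ∈ X(f); if z had period p, all these prefixes, which are
-- arbitrarily long, would have period p, and x would be periodic.
module Submission where

open import Defs
open import Data.Nat using (ℕ)
open import Data.Fin using (Fin)
open import Data.List using (_∷_; [])
open import Data.List.Membership.Propositional using (_∈_)
open import Data.Product using (∃-syntax)
open import Relation.Nullary using (¬_)

open import Data.Nat using (zero; suc; _+_; _≤_; _<_; z≤n; s≤s)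
open import Data.Nat.Properties
  using (≤-trans; ≤-reflexive; <⇒≱; m≤m+n; ≤-<-trans; +-assoc; +-comm; +-cancelˡ-<; +-monoˡ-≤;
         module ≤-Reasoning)
open import Data.Integer using (ℤ; +_; _*_) renaming (_+_ to _+ᶻ_)
open import Data.Integer.Properties using (i*j≡0⇒i≡0∨j≡0; +-injective; *-zeroʳ)
  renaming (+-identityˡ to +ᶻ-identityˡ; +-identityʳ to +ᶻ-identityʳ; +-assoc to +ᶻ-assoc)
open import Data.Fin using (toℕ)
open import Data.Fin.Properties using (_≟_)
open import Data.List using (List; _++_; length; map; concatMap; applyUpTo; lookup; upTo; allFin)
open import Data.List.Properties
  using (∷-injective; ∷-injectiveˡ; ∷-injectiveʳ; ≡-dec; ++-assoc; ++-identityʳ; length-++;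
         length-++-≤ˡ; length-++-≤ʳ; concatMap-++; map-upTo; length-map; length-upTo)
open import Data.List.Extrema.Nat using (max; xs≤max)
open import Data.List.Membership.Propositional.Properties using (∈-∃++; ∈-concatMap⁺; ∈-allFin)
open import Data.List.Relation.Unary.All as All using ()
open import Data.List.Relation.Unary.All.Properties using (map⁻)
open import Data.List.Relation.Unary.Any as Any using (here; there)
open import Data.Product using (_×_; _,_; map₂)
open import Data.Sum using (_⊎_; inj₁; inj₂; [_,_]′)
open import Function using (_∘_; id)
open import Relation.Binary.PropositionalEquality
open import Relation.Nullary using (yes; no; contradiction)

module _ {A : Set} where

  ++-equidivisible : ∀ (xs ys us vs : List A) → xs ++ ys ≡ us ++ vs →
                     (∃[ m ] (us ≡ xs ++ m × ys ≡ m ++ vs)) ⊎ (∃[ m ] (xs ≡ us ++ m × vs ≡ m ++ ys))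
  ++-equidivisible []       ys us       vs eq = inj₁ (us , refl , eq)
  ++-equidivisible (x ∷ xs) ys []       vs eq = inj₂ (x ∷ xs , refl , sym eq)
  ++-equidivisible (x ∷ xs) ys (u ∷ us) vs eq with refl , eq′ ← ∷-injective eq
    with ++-equidivisible xs ys us vs eq′
  ... | inj₁ (m , us≡ , ys≡) = inj₁ (m , cong (x ∷_) us≡ , ys≡)
  ... | inj₂ (m , xs≡ , vs≡) = inj₂ (m , cong (x ∷_) xs≡ , vs≡)

  applyUpTo-prefix : ∀ (h : ℕ → A) n v t → applyUpTo h n ≡ v ++ t → v ≡ applyUpTo h (length v)
  applyUpTo-prefix h n       []      t eq = refl
  applyUpTo-prefix h zero    (c ∷ v) t ()
  applyUpTo-prefix h (suc n) (c ∷ v) t eq with refl , eq′ ← ∷-injective eq =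
    cong (h 0 ∷_) (applyUpTo-prefix (h ∘ suc) n v t eq′)

  applyUpTo-infix : ∀ (h : ℕ → A) n s v t → applyUpTo h n ≡ s ++ v ++ t →
                    v ≡ applyUpTo (λ j → h (length s + j)) (length v)
  applyUpTo-infix h n       []      v t eq = applyUpTo-prefix h n v t eq
  applyUpTo-infix h zero    (c ∷ s) v t ()
  applyUpTo-infix h (suc n) (c ∷ s) v t eq = applyUpTo-infix (h ∘ suc) n s v t (∷-injectiveʳ eq)

  applyUpTo-lookup : ∀ (g : ℕ → A) v → (∀ i → g (toℕ i) ≡ lookup v i) → applyUpTo g (length v) ≡ v
  applyUpTo-lookup g []      _     = refl
  applyUpTo-lookup g (c ∷ v) agree =
    cong₂ _∷_ (agree Data.Fin.zero) (applyUpTo-lookup (g ∘ suc) v (agree ∘ Data.Fin.suc))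

  applyUpTo-injective : ∀ (g h : ℕ → A) n → applyUpTo g n ≡ applyUpTo h n → ∀ j → j < n → g j ≡ h j
  applyUpTo-injective g h (suc n) eq zero    _         = ∷-injectiveˡ eq
  applyUpTo-injective g h (suc n) eq (suc j) (s≤s j<n) =
    applyUpTo-injective (g ∘ suc) (h ∘ suc) n (∷-injectiveʳ eq) j j<n

length-window : ∀ {k} (z : ℤ → Fin k) i m → length (window z i m) ≡ m
length-window z i m = trans (length-map _ (upTo m)) (length-upTo m)

IsFactor-window : ∀ {k} {z : ℤ → Fin k} {W v} → IsFactor v (window z (+ 0) W) →
                  ∃[ s ] (v ≡ applyUpTo (λ j → z (+ (s + j))) (length v))
IsFactor-window {z = z} {W} {v} (s , t , eq) =
  length s , applyUpTo-infix (z ∘ +_) W s v t (trans (sym (map-upTo (z ∘ +_) W)) eq)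

bounded : ∀ {k} (h : Fin k → ℕ) → ∃[ M ] (∀ c → h c ≤ M)
bounded {k} h = max 0 hs , λ c → All.lookup (map⁻ (xs≤max 0 hs)) (∈-allFin c)
  where hs = map h (allFin k)

module _ {k : ℕ} where

  IsFactor-trans : {u v w : List (Fin k)} → IsFactor u v → IsFactor v w → IsFactor u w
  IsFactor-trans {u} (r , s , refl) (r′ , s′ , refl) = r′ ++ r , s ++ s′ , (begin
    r′ ++ (r ++ u ++ s) ++ s′  ≡⟨ cong (r′ ++_) (++-assoc r (u ++ s) s′) ⟩
    r′ ++ r ++ (u ++ s) ++ s′  ≡⟨ cong (λ y → r′ ++ r ++ y) (++-assoc u s s′) ⟩
    r′ ++ r ++ u ++ s ++ s′    ≡⟨ ++-assoc r′ r _ ⟨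
    (r′ ++ r) ++ u ++ s ++ s′  ∎)
    where open ≡-Reasoning

  suffix⇒IsFactor : ∀ {u w : List (Fin k)} r → w ≡ r ++ u → IsFactor u w
  suffix⇒IsFactor {u} r eq = r , [] , trans eq (cong (r ++_) (sym (++-identityʳ u)))

  ∈⇒IsFactor : ∀ {b : Fin k} {w} → b ∈ w → IsFactor (b ∷ []) w
  ∈⇒IsFactor b∈w with ys , zs , eq ← ∈-∃++ b∈w = ys , zs , eq

module _ {X : Set} {k : ℕ} (g : X → List (Fin k)) {M : ℕ} (short : ∀ c → length (g c) ≤ M) where

  suffix-of-blocks : ∀ xs s v → concatMap g xs ≡ s ++ v →
                     ∃[ r ] ∃[ ys ] (length r ≤ M × v ≡ r ++ concatMap g ys)
  suffix-of-blocks []       []      v eq = [] , [] , z≤n , sym eq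
  suffix-of-blocks []       (_ ∷ _) v ()
  suffix-of-blocks (c ∷ xs) s       v eq with ++-equidivisible (g c) (concatMap g xs) s v eq
  ... | inj₁ (s′ , _ , rest≡) = suffix-of-blocks xs s′ v rest≡
  ... | inj₂ (r , gc≡sr , v≡) =
    r , xs , ≤-trans (length-++-≤ʳ r {s}) (≤-trans (≤-reflexive (cong length (sym gc≡sr))) (short c)) , v≡

  block-in-long-prefix : ∀ xs w t → concatMap g xs ≡ w ++ t → M < length w →
                         ∃[ c ] (g c ≢ [] × IsFactor (g c) w)
  block-in-long-prefix []       []      t _  ()
  block-in-long-prefix []       (_ ∷ _) t () _
  block-in-long-prefix (c ∷ xs) w       t eq M<w with ≡-dec _≟_ (g c) []
  ... | yes gc≡[] = block-in-long-prefix xs w t (trans (cong (_++ concatMap g xs) (sym gc≡[])) eq) M<w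
  ... | no gc≢[] with ++-equidivisible (g c) (concatMap g xs) w t eq
  ...   | inj₁ (m , w≡ , _) = c , gc≢[] , [] , m , w≡
  ...   | inj₂ (m , gc≡ , _) = contradiction
          (≤-trans (length-++-≤ˡ w) (≤-trans (≤-reflexive (cong length (sym gc≡))) (short c))) (<⇒≱ M<w)

  block-in-long-factor : ∀ xs s w t → concatMap g xs ≡ s ++ w ++ t → M + M < length w →
                         ∃[ c ] (g c ≢ [] × IsFactor (g c) w)
  block-in-long-factor xs s w t eq 2M<w with r , ys , r≤M , wt≡ ← suffix-of-blocks xs s (w ++ t) eq
    with ++-equidivisible w t r (concatMap g ys) wt≡
  ... | inj₁ (m , r≡ , _) = contradiction
        (≤-trans (length-++-≤ˡ w) (≤-trans (≤-reflexive (cong length (sym r≡))) (≤-trans r≤M (m≤m+n M M))))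
        (<⇒≱ 2M<w)
  ... | inj₂ (m , w≡ , blocks≡) =
        map₂ (map₂ (λ fac → IsFactor-trans fac (suffix⇒IsFactor r w≡)))
             (block-in-long-prefix ys m t blocks≡ M<m)
    where
      open ≤-Reasoning
      M<m : M < length m
      M<m = +-cancelˡ-< M M (length m) (begin-strict
        M + M               <⟨ 2M<w ⟩
        length w            ≡⟨ cong length w≡ ⟩
        length (r ++ m)     ≡⟨ length-++ r ⟩
        length r + length m ≤⟨ +-monoˡ-≤ (length m) r≤M ⟩
        M + length m        ∎)

module _ {k : ℕ} where

  count-self : ∀ (b : Fin k) w → count b (b ∷ w) ≢ 0
  count-self b w with b ≟ b
  ... | yes _   = λ ()
  ... | no b≢b = contradiction refl b≢b

  count≢0⇒∈ : ∀ {b : Fin k} w → count b w ≢ 0 → b ∈ w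
  count≢0⇒∈         []      count≢0 = contradiction refl count≢0
  count≢0⇒∈ {b = b} (c ∷ w) count≢0 with b ≟ c
  ... | yes b≡c = here b≡c
  ... | no _    = there (count≢0⇒∈ w count≢0)

  count≡0⇒[] : ∀ (w : List (Fin k)) → (∀ b → count b w ≡ 0) → w ≡ []
  count≡0⇒[] []      _        = refl
  count≡0⇒[] (c ∷ w) count≡0 = contradiction (count≡0 c) (count-self c w)

  LinDep-support : ∀ {v w : Fin k → ℕ} {b} → LinDep v w → v b ≢ 0 → w b ≡ 0 → ∀ c → w c ≡ 0
  LinDep-support {v} {w} {b} (p , q , nontrivial , relation) vb≢0 wb≡0 c =
    [ (λ q≡0 → contradiction (p≡0 , q≡0) nontrivial) , +-injective ]′ (i*j≡0⇒i≡0∨j≡0 q q*wc≡0)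
    where
      open ≡-Reasoning
      p≡0 : p ≡ + 0
      p≡0 = [ id , (λ vb≡0 → contradiction (+-injective vb≡0) vb≢0) ]′ (i*j≡0⇒i≡0∨j≡0 p (begin
        p * + v b                 ≡⟨ +ᶻ-identityʳ _ ⟨
        p * + v b +ᶻ + 0          ≡⟨ cong (p * + v b +ᶻ_) (*-zeroʳ q) ⟨
        p * + v b +ᶻ q * + 0      ≡⟨ cong (λ n → p * + v b +ᶻ q * + n) wb≡0 ⟨
        p * + v b +ᶻ q * + w b    ≡⟨ relation b ⟩
        + 0                       ∎))
      q*wc≡0 : q * + w c ≡ + 0
      q*wc≡0 = begin
        q * + w c                 ≡⟨ +ᶻ-identityˡ _ ⟨
        + 0 * + v c +ᶻ q * + w c  ≡⟨ cong (λ p′ → p′ * + v c +ᶻ q * + w c) p≡0 ⟨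
        p * + v c +ᶻ q * + w c    ≡⟨ relation c ⟩
        + 0                       ∎

∈-nonempty-image : ∀ {k} {f : Morphism k} {a u} → ParikhCollinear f → f a ≡ a ∷ u →
                   ∀ {c} → f c ≢ [] → a ∈ f c
∈-nonempty-image {f = f} {a} {u} collinear fa {c} fc≢[] = count≢0⇒∈ (f c) λ count≡0 →
  fc≢[] (count≡0⇒[] (f c) (LinDep-support (collinear a c) count-a-fa≢0 count≡0))
  where
    count-a-fa≢0 : count a (f a) ≢ 0
    count-a-fa≢0 = subst (λ w → count a w ≢ 0) (sym fa) (count-self a u)

module Iterates {k : ℕ} (f : Morphism k) where

  iter-[] : ∀ n → iter f n [] ≡ []
  iter-[] zero    = refl
  iter-[] (suc n) = cong (apply f) (iter-[] n)

  iter-++ : ∀ n (u v : List (Fin k)) → iter f n (u ++ v) ≡ iter f n u ++ iter f n v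
  iter-++ zero    u v = refl
  iter-++ (suc n) u v = trans (cong (apply f) (iter-++ n u v)) (concatMap-++ f (iter f n u) (iter f n v))

  iter-concatMap : ∀ {X : Set} n (h : X → List (Fin k)) xs →
                   iter f n (concatMap h xs) ≡ concatMap (iter f n ∘ h) xs
  iter-concatMap n h []       = iter-[] n
  iter-concatMap n h (x ∷ xs) =
    trans (iter-++ n (h x) (concatMap h xs)) (cong (iter f n (h x) ++_) (iter-concatMap n h xs))

  iter-+ : ∀ m d w → iter f m (iter f d w) ≡ iter f (m + d) w
  iter-+ zero    d w = refl
  iter-+ (suc m) d w = cong (apply f) (iter-+ m d w)

  iter-comm : ∀ m d w → iter f m (iter f d w) ≡ iter f d (iter f m w)
  iter-comm m d w = trans (iter-+ m d w) (trans (cong (λ e → iter f e w) (+-comm m d)) (sym (iter-+ d m w)))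

  iter-suc-blocks : ∀ n w → iter f (suc n) w ≡ concatMap (iter f n ∘ f) w
  iter-suc-blocks n w = trans (iter-comm 1 n w) (iter-concatMap n f w)

  iter-IsFactor : ∀ n {u v} → IsFactor u v → IsFactor (iter f n u) (iter f n v)
  iter-IsFactor n {u} (r , s , refl) =
    iter f n r , iter f n s , trans (iter-++ n r (u ++ s)) (cong (iter f n r ++_) (iter-++ n u s))

module _ {k : ℕ} {f : Morphism k} {a : Fin k} {u : List (Fin k)} (fa : f a ≡ a ∷ u) where
  open Iterates f

  ∈-iter-self : ∀ d → a ∈ iter f d (a ∷ [])
  ∈-iter-self zero    = here refl
  ∈-iter-self (suc d) =
    ∈-concatMap⁺ f (Any.map (λ { refl → subst (a ∈_) (sym fa) (here refl) }) (∈-iter-self d))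

  iterate-IsFactor-iter : ∀ m d → IsFactor (iter f m (a ∷ [])) (iter f d (iter f m (a ∷ [])))
  iterate-IsFactor-iter m d = subst (IsFactor (iter f m (a ∷ []))) (iter-comm m d (a ∷ []))
                                     (iter-IsFactor m (∈⇒IsFactor (∈-iter-self d)))

  module _ (collinear : ParikhCollinear f) (reach : ∀ (b : Fin k) → ∃[ n ] (b ∈ iter f n (a ∷ []))) where

    InLanguage⇒IsFactor-iterate : ∀ {w} → InLanguage f w → ∃[ m ] IsFactor w (iter f m (a ∷ []))
    InLanguage⇒IsFactor-iterate (j , b , w⊑) with i , b∈ ← reach b =
      j + i , IsFactor-trans w⊑ (subst (IsFactor (iter f j (b ∷ []))) (iter-+ j i (a ∷ []))
                                       (iter-IsFactor j (∈⇒IsFactor b∈)))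

    long-factors-contain-iterate : ∀ n → ∃[ K ] (∀ w → K < length w → InLanguage f w →
                                                   IsFactor (iter f n (a ∷ [])) w)
    long-factors-contain-iterate n with M , short ← bounded (λ c → length (iter f n (f c))) =
      M + M , λ w K<w w∈L → contains w K<w (InLanguage⇒IsFactor-iterate w∈L)
      where
        contains : ∀ w → M + M < length w → ∃[ m ] IsFactor w (iter f m (a ∷ [])) →
                   IsFactor (iter f n (a ∷ [])) w
        contains w K<w (m , w⊑)
          with s , t , eq ← IsFactor-trans w⊑ (iterate-IsFactor-iter m (suc n))
          with c , block≢[] , block⊑w ← block-in-long-factor (iter f n ∘ f) short (iter f m (a ∷ [])) s w t
                                          (trans (sym (iter-suc-blocks n (iter f m (a ∷ [])))) eq) K<w =
          IsFactor-trans (iter-IsFactor n (∈⇒IsFactor a∈fc)) block⊑w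
          where
            a∈fc : a ∈ f c
            a∈fc = ∈-nonempty-image {f = f} collinear fa λ fc≡[] →
                     block≢[] (trans (cong (iter f n) fc≡[]) (iter-[] n))

    iterate-occurs-in-shift : (x : ℕ → Fin k) → IsFixedPointLimit f a x → ∀ {z} → InShift f z →
                              ∀ n → ∃[ s ] (∀ j → j < length (iter f n (a ∷ [])) → x j ≡ z (+ (s + j)))
    iterate-occurs-in-shift x fix {z} z∈X n = agreement (long-factors-contain-iterate n)
      where
        v = iter f n (a ∷ [])
        agreement : ∃[ K ] (∀ w → K < length w → InLanguage f w → IsFactor v w) →
                    ∃[ s ] (∀ j → j < length v → x j ≡ z (+ (s + j)))
        agreement (K , contains) =
          map₂ (λ {s} v≡ → applyUpTo-injective x (λ j → z (+ (s + j))) (length v)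
                                                (trans (applyUpTo-lookup x v (fix n)) v≡))
               (IsFactor-window {z = z} (contains (window z (+ 0) (suc K))
                                          (≤-reflexive (sym (length-window z (+ 0) (suc K))))
                                          (z∈X (+ 0) (suc K))))

shiftN-apply : ∀ {k} n (z : ℤ → Fin k) i → shiftN n z i ≡ z (i +ᶻ + n)
shiftN-apply zero    z i = cong z (sym (+ᶻ-identityʳ i))
shiftN-apply (suc n) z i = trans (shiftN-apply n z (i +ᶻ + 1)) (cong z (+ᶻ-assoc i (+ 1) (+ n)))

periodic-on-window : ∀ {A : Set} (x y : ℕ → A) {p} → (∀ m → y (m + p) ≡ y m) →
                     ∀ {s L} → (∀ j → j < L → x j ≡ y (s + j)) → ∀ {i} → i + p < L → x (i + p) ≡ x i
periodic-on-window x y {p} y-periodic {s} agree {i} i+p<L = begin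
  x (i + p)        ≡⟨ agree (i + p) i+p<L ⟩
  y (s + (i + p))  ≡⟨ cong y (+-assoc s i p) ⟨
  y (s + i + p)    ≡⟨ y-periodic (s + i) ⟩
  y (s + i)        ≡⟨ agree i (≤-<-trans (m≤m+n i p) i+p<L) ⟨
  x i              ∎
  where open ≡-Reasoning

proposition9 : ∀ {k : ℕ} (f : Morphism k) (a : Fin k) →
    ParikhCollinear f →
    Prolongable f a →
    (∀ (b : Fin k) → ∃[ n ] (b ∈ iter f n (a ∷ []))) →
    (x : ℕ → Fin k) → IsFixedPointLimit f a x →
    ¬ UltimatelyPeriodic x →
    AperiodicShift f
proposition9 f a collinear ((u , fa) , unbounded) reach x fix not-periodic z z∈X (p , 0<p , z-periodic) =
  not-periodic (p , 0 , 0<p , λ i _ → x-periodic i)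
  where
    x-periodic : ∀ i → x (i + p) ≡ x i
    x-periodic i =
      let n , i+p<L = unbounded (suc (i + p))
          s , agree = iterate-occurs-in-shift fa collinear reach x fix {z} z∈X n
      in periodic-on-window x (z ∘ +_) (λ m → trans (sym (shiftN-apply p z (+ m))) (z-periodic (+ m)))
                            agree i+p<L
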